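{- For $n\geq 1$, we have \begin{equation}p_n=\left|% \begin{array}{ccccc} {e}_1 & 2{e}_2 & 3{e}_{3}&\cdots&n{e}_n \\ 1 & e_1 & e_2 & \cdots &e_{n-1} \\ 0 & 1 & e_1 & \cdots &e_{n-2}\\ \vdots & \ddots & \ddots& \ddots&\vdots \\ 0 & 0 & 0&&e_1 \\ \end{array}% \right|, \quad n!\,e_n=\left|% \begin{array}{ccccc} {p}_1 & p_2 &\cdots&p_{n-1}&p_n \\ 1 & p_1 & \cdots &p_{n-2}&p_{n-1} \\ 0 & 2& \ddots &p_{n-3}&p_{n-2}\\ \vdots & \ddots & \ddots& \ddots &\vdots \\ 0 & 0 &\cdots&n-1&p_1 \\ \end{array}% \right|.\end{equation}For $n\geq 0$, we have \begin{equation}\tilde{p}_n=\left|% \begin{array}{ccccc} \tilde{e}_0 & \tilde{e}_1 & \tilde{e}_2 & \cdots&\tilde{e}_n \\ 1 & e_1 & e_2 & \cdots &e_{n} \\ 0 & 1 & e_1 & \cdots &e_{n-1} \\ \vdots & \ddots & \ddots&\ddots&\vdots \\ 0 & 0 & 0 & &e_1 \\ \end{array}% \right| ,\quad {n!\,}\tilde{e}_n=\left|% \begin{array}{ccccc} \tilde{p}_0 & \tilde{p}_1 & \cdots&\tilde{p}_{n-1}&\tilde{p}_n \\ n & p_1 & \cdots &p_{n-1}&p_{n} \\ 0 & n-1 & \ddots &p_{n-2}&p_{n-1} \\ \vdots & \ddots & \ddots&\ddots &\vdots \\ 0 & 0 & \cdots & 1&p_1 \\ \end{array}% \right|.\end{equation}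 Similar formulas for the complete symmetric functions are obtained by using the involution $\hat\omega$.
   Context: We work with commuting variables $x_1,x_2,\ldots$ and anticommuting (Grassmann) variables $\theta_1,\theta_2,\ldots$ (infinitely many of each), in the ring of superpolynomials invariant under simultaneous permutation of the $x_i$ and the $\theta_i$. The bosonic and fermionic elementary symmetric functions are, for $n\geq1$, $e_n=\sum_{j_1<\cdots<j_n}x_{j_1}\cdots x_{j_n}$ and $\tilde e_n=\sum_i\sum_{j_1<\cdots<j_n,\ i\notin\{j_1,\ldots,j_n\}}\theta_i x_{j_1}\cdots x_{j_n}$, with $e_0=1$ and $\tilde e_0=\sum_i\theta_i$; equivalently $\sum_{n\ge0}t^n(e_n+\tau\tilde e_n)=\prod_i(1+tx_i+\tau\theta_i)$ with $t$ commuting and $\tau$ anticommuting. The complete symmetric functions $h_n,\tilde h_n$ are given by $\sum_{n\ge0}t^n(h_n+\tau\tilde h_n)=\prod_i(1-tx_i-\tau\theta_i)^{ -1}$. The power sums are $p_n=\sum_i x_i^n$ for $n\ge1$ with $p_0=0$, and $\tilde p_n=\sum_i\theta_i x_i^n$ for $n\geq0$. The involution $\hat\omega$ is the ring homomorphism defined by $e_n\mapsto h_n$, $\tilde e_n\mapsto\tilde h_n$ (it satisfies $\hat\omega^2=1$). -}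

module Defs where

open import Level using (Level)
open import Algebra.Bundles using (Ring)
open import Data.Nat using (ℕ; zero; suc; _∸_; _≤ᵇ_; _≡ᵇ_; _!)
open import Data.Fin using (Fin; zero; suc; toℕ; punchIn)
open import Data.Bool using (if_then_else_)
open import Data.Product using (_×_)
open import Function using (_∘_)

-- Everything is developed over an arbitrary (not necessarily commutative)
-- ring R, with N "bosonic" values x i and N "fermionic" values θ i.
module Sym {c ℓ : Level} (R : Ring c ℓ) where
  open Ring R hiding (zero)

  fromℕ : ℕ → Carrier
  fromℕ zero    = 0#
  fromℕ (suc n) = 1# + fromℕ n

  pow : Carrier → ℕ → Carrier
  pow a zero    = 1#
  pow a (suc n) = a * pow a n

  sgn : ℕ → Carrier
  sgn zero    = 1#
  sgn (suc k) = - sgn k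

  sumF : ∀ {N} → (Fin N → Carrier) → Carrier
  sumF {zero}  f = 0#
  sumF {suc N} f = f zero + sumF (f ∘ suc)

  SuperVars : ∀ {N} → (Fin N → Carrier) → (Fin N → Carrier) → Set (c Level.⊔ ℓ)
  SuperVars x θ =
    (∀ i a → x i * a ≈ a * x i) ×
    (∀ i j → θ i * θ j ≈ - (θ j * θ i)) ×
    (∀ i → θ i * θ i ≈ 0#)

  -- e_n : coefficient of t^n in ∏_i (1 + t x_i)   (e_0 = 1)
  e : ∀ {N} → (Fin N → Carrier) → ℕ → Carrier
  e {zero}  x zero    = 1#
  e {zero}  x (suc k) = 0#
  e {suc N} x zero    = 1#
  e {suc N} x (suc k) = x zero * e (x ∘ suc) k + e (x ∘ suc) (suc k)

  -- ẽ_n : coefficient of τ t^n in ∏_i (1 + t x_i + τ θ_i), i.e.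
  -- ẽ_n = Σ_i θ_i Σ_{j_1<…<j_n, i ∉ {j}} x_{j_1}⋯x_{j_n}
  et : ∀ {N} → (Fin N → Carrier) → (Fin N → Carrier) → ℕ → Carrier
  et {zero}  x θ k       = 0#
  et {suc N} x θ zero    = θ zero + et (x ∘ suc) (θ ∘ suc) zero
  et {suc N} x θ (suc k) =
    θ zero * e (x ∘ suc) (suc k) + x zero * et (x ∘ suc) (θ ∘ suc) k
      + et (x ∘ suc) (θ ∘ suc) (suc k)

  p : ∀ {N} → (Fin N → Carrier) → ℕ → Carrier
  p x zero    = 0#
  p x (suc n) = sumF (λ i → pow (x i) (suc n))

  pt : ∀ {N} → (Fin N → Carrier) → (Fin N → Carrier) → ℕ → Carrier
  pt x θ n = sumF (λ i → θ i * pow (x i) n)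

  -- determinant by Laplace expansion along the first row; in each term the
  -- first-row entry is the leftmost factor (rows below the first are even here)
  det : ∀ {n} → (Fin n → Fin n → Carrier) → Carrier
  det {zero}  M = 1#
  det {suc n} M =
    sumF (λ j → sgn (toℕ j) * (M zero j * det (λ i k → M (suc i) (punchIn j k))))

  band : (ℕ → Carrier) → ℕ → ℕ → Carrier
  band f i' j = if i' ≤ᵇ j then f (j ∸ i') else 0#

  bandD : (ℕ → Carrier) → Carrier → ℕ → ℕ → Carrier
  bandD f d i' j =
    if i' ≤ᵇ j then (if i' ≡ᵇ j then d else f (j ∸ i')) else 0#

  Mpe : ∀ {N} → (Fin N → Carrier) → (n : ℕ) → Fin n → Fin n → Carrier
  Mpe x n zero    j = fromℕ (suc (toℕ j)) * e x (suc (toℕ j))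
  Mpe x n (suc i) j = band (e x) (toℕ i) (toℕ j)

  Mep : ∀ {N} → (Fin N → Carrier) → (n : ℕ) → Fin n → Fin n → Carrier
  Mep x n zero    j = p x (suc (toℕ j))
  Mep x n (suc i) j = bandD (p x) (fromℕ (suc (toℕ i))) (toℕ i) (toℕ j)

  Mpte : ∀ {N} → (Fin N → Carrier) → (Fin N → Carrier) → (n : ℕ)
       → Fin (suc n) → Fin (suc n) → Carrier
  Mpte x θ n zero    j = et x θ (toℕ j)
  Mpte x θ n (suc i) j = band (e x) (toℕ i) (toℕ j)

  Mept : ∀ {N} → (Fin N → Carrier) → (Fin N → Carrier) → (n : ℕ)
       → Fin (suc n) → Fin (suc n) → Carrier
  Mept x θ n zero    j = pt x θ (toℕ j)
  Mept x θ n (suc i) j = bandD (p x) (fromℕ (n ∸ toℕ i)) (toℕ i) (toℕ j)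

module Submission where

-- All the determinants consist of a first row above a banded Toeplitz part. Expanding along the
-- first column, whose only nonzero entries are the top two, gives a recursion in the size in
-- which only the first row changes, and the determinant is linear in that row. It therefore
-- suffices to know the determinants with first row (e⁽ⁱ⁾_c)_c resp. (x_i^c)_c, where e⁽ⁱ⁾ are the
-- elementary symmetric functions of the variables other than x_i: by the recursion and
-- e_(k+1) = e⁽ⁱ⁾_(k+1) + x_i e⁽ⁱ⁾_k they are x_i^n resp. n! e⁽ⁱ⁾_n (the latter induction also
-- uses p_(c+1) = Σ_j x_j x_j^c and Σ_j x_j e⁽ʲ⁾_k = (k+1) e_(k+1)). Since (k+1) e_(k+1) = Σ_i x_i e⁽ⁱ⁾_k, ẽ_k = Σ_i θ_i e⁽ⁱ⁾_k and p̃_k = Σ_i θ_i x_i^k,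
-- this gives three of the four identities. The matrix for n! e_n has subdiagonal 1, 2, …, n-1,
-- which does not survive deleting the first row and column; it is upper Hessenberg, so we expand
-- it along the last row instead and use Newton's identity
-- Σ_c (-1)^c e_c p_(k+1-c) = (-1)^k (k+1) e_(k+1).
-- All bosonic computations take place in the commutative ring of central elements of R, which
-- contains the x_i, and are transported back along the inclusion.

open import Defs
open import Level using (_⊔_)
open import Algebra.Bundles using (Ring; CommutativeRing; RawRing)
open import Algebra.Morphism.Structures using (IsRingHomomorphism; IsRingMonomorphism)
import Algebra.Morphism.RingMonomorphism as RingMonomorphism
open import Data.Bool using (true; false; if_then_else_)
open import Data.Fin using (Fin; zero; suc; toℕ; punchIn)
open import Data.Fin.Properties using (toℕ<n; toℕ-inject₁; toℕ-fromℕ)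
open import Data.Nat using (ℕ; zero; suc; _∸_; _!; _≤ᵇ_; _≡ᵇ_; _<_; _≤_; z≤n; s≤s; s≤s⁻¹; _≟_)
open import Data.Nat.Properties using (≤-refl; ≤-trans; <⇒≢; n<1+n; n≤1+n; +-∸-assoc; n∸n≡0)
open import Data.Product using (Σ; _,_; proj₁; proj₂; _×_)
open import Data.Vec.Functional using (removeAt)
open import Function using (_∘_)
open import Relation.Nullary using (yes; no)
open import Relation.Nullary.Decidable using (dec-true; dec-false)
import Relation.Binary.PropositionalEquality as ≡
open ≡ using (_≡_)

punchInℕ : ℕ → ℕ → ℕ
punchInℕ zero    c       = suc c
punchInℕ (suc j) zero    = zero
punchInℕ (suc j) (suc c) = suc (punchInℕ j c)

toℕ-punchIn : ∀ {n} (j : Fin (suc n)) (k : Fin n) → toℕ (punchIn j k) ≡ punchInℕ (toℕ j) (toℕ k)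
toℕ-punchIn zero    k       = ≡.refl
toℕ-punchIn (suc j) zero    = ≡.refl
toℕ-punchIn (suc j) (suc k) = ≡.cong suc (toℕ-punchIn j k)

punchInℕ-≤ : ∀ j c → punchInℕ j c ≤ suc c
punchInℕ-≤ zero    c       = ≤-refl
punchInℕ-≤ (suc j) zero    = z≤n
punchInℕ-≤ (suc j) (suc c) = s≤s (punchInℕ-≤ j c)

punchInℕ-< : ∀ {j c} → c < j → punchInℕ j c ≡ c
punchInℕ-< {suc j} {zero}  _         = ≡.refl
punchInℕ-< {suc j} {suc c} (s≤s c<j) = ≡.cong suc (punchInℕ-< c<j)

punchInℕ-≥ : ∀ {j c} → j ≤ c → punchInℕ j c ≡ suc c
punchInℕ-≥ {zero}  {c}     _         = ≡.refl
punchInℕ-≥ {suc j} {suc c} (s≤s j≤c) = ≡.cong suc (punchInℕ-≥ j≤c)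

punchInℕ-≡ᵇ : ∀ {j k} c → j ≤ k → (punchInℕ j c ≡ᵇ suc k) ≡ (c ≡ᵇ k)
punchInℕ-≡ᵇ {zero}          c       _         = ≡.refl
punchInℕ-≡ᵇ {suc j} {suc k} zero    _         = ≡.refl
punchInℕ-≡ᵇ {suc j} {suc k} (suc c) (s≤s j≤k) = punchInℕ-≡ᵇ c j≤k

Matrix : ∀ {a} → Set a → Set a
Matrix A = ℕ → ℕ → A

_∷_ : ∀ {a} {A : Set a} → A → (ℕ → A) → ℕ → A
(x ∷ xs) zero    = x
(x ∷ xs) (suc n) = xs n

module Scalars {c ℓ} (R : Ring c ℓ) where
  open Ring R hiding (zero)
  open Sym R using (fromℕ; sgn)
  open import Algebra.Properties.Ring R using (-‿distribˡ-*; -‿distribʳ-*)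
  open import Algebra.Properties.Group +-group using (⁻¹-involutive)
  open import Algebra.Properties.Semiring.Mult semiring
    using (×1-homo-*; ×-comm-*; ×-assoc-*; ×-congʳ) renaming (_×_ to _·_)
  open import Relation.Binary.Reasoning.Setoid setoid

  sgn-central : ∀ k a → sgn k * a ≈ a * sgn k
  sgn-central zero    a = trans (*-identityˡ a) (sym (*-identityʳ a))
  sgn-central (suc k) a = begin
    - sgn k * a    ≈⟨ -‿distribˡ-* (sgn k) a ⟨
    - (sgn k * a)  ≈⟨ -‿cong (sgn-central k a) ⟩
    - (a * sgn k)  ≈⟨ -‿distribʳ-* a (sgn k) ⟩
    a * - sgn k    ∎

  sgn-sgn : ∀ k → sgn k * sgn k ≈ 1#
  sgn-sgn zero    = *-identityˡ 1#
  sgn-sgn (suc k) = begin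
    - sgn k * - sgn k    ≈⟨ -‿distribˡ-* (sgn k) _ ⟨
    - (sgn k * - sgn k)  ≈⟨ -‿cong (-‿distribʳ-* (sgn k) _) ⟨
    - - (sgn k * sgn k)  ≈⟨ ⁻¹-involutive _ ⟩
    sgn k * sgn k        ≈⟨ sgn-sgn k ⟩
    1#                   ∎

  fromℕ≈·1 : ∀ n → fromℕ n ≈ n · 1#
  fromℕ≈·1 zero    = refl
  fromℕ≈·1 (suc n) = +-congˡ (fromℕ≈·1 n)

  fromℕ-* : ∀ m n → fromℕ (m Data.Nat.* n) ≈ fromℕ m * fromℕ n
  fromℕ-* m n = begin
    fromℕ (m Data.Nat.* n)         ≈⟨ fromℕ≈·1 (m Data.Nat.* n) ⟩
    (m Data.Nat.* n) · 1#          ≈⟨ ×1-homo-* m n ⟩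
    (m · 1#) * (n · 1#)            ≈⟨ *-cong (fromℕ≈·1 m) (fromℕ≈·1 n) ⟨
    fromℕ m * fromℕ n              ∎

  fromℕ-central : ∀ n a → fromℕ n * a ≈ a * fromℕ n
  fromℕ-central n a = begin
    fromℕ n * a     ≈⟨ *-congʳ (fromℕ≈·1 n) ⟩
    (n · 1#) * a    ≈⟨ ×-assoc-* n 1# a ⟩
    n · (1# * a)    ≈⟨ ×-congʳ n (trans (*-identityˡ a) (sym (*-identityʳ a))) ⟩
    n · (a * 1#)    ≈⟨ ×-comm-* n a 1# ⟨
    a * (n · 1#)    ≈⟨ *-congˡ (fromℕ≈·1 n) ⟨
    a * fromℕ n     ∎

module Sums {c ℓ} (R : Ring c ℓ) where
  open Ring R hiding (zero)
  open Sym R using (sumF)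
  open import Algebra.Properties.Semiring.Sum semiring
  open import Algebra.Properties.AbelianGroup +-abelianGroup using (⁻¹-∙-comm)
  open import Algebra.Properties.Group +-group using (ε⁻¹≈ε)

  sumF≈sum : ∀ {n} (f : Fin n → Carrier) → sumF f ≈ sum f
  sumF≈sum {zero}  f = refl
  sumF≈sum {suc n} f = +-congˡ (sumF≈sum (f ∘ suc))

  ∑-zero : ∀ {n} (f : Fin n → Carrier) → (∀ i → f i ≈ 0#) → sum f ≈ 0#
  ∑-zero {n} f f≈0 = trans (sum-cong-≋ f≈0) (sum-replicate-zero n)

  ∑-neg : ∀ {n} (f : Fin n → Carrier) → - sum f ≈ ∑[ i < n ] (- f i)
  ∑-neg {zero}  f = ε⁻¹≈ε
  ∑-neg {suc n} f = trans (sym (⁻¹-∙-comm _ _)) (+-congˡ (∑-neg (f ∘ suc)))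

  ∑-distrib-sub : ∀ {n} (f g : Fin n → Carrier) → ∑[ i < n ] (f i - g i) ≈ sum f - sum g
  ∑-distrib-sub f g = trans (∑-distrib-+ f (λ i → - g i)) (+-congˡ (sym (∑-neg g)))

  ∑ℕ : ℕ → (ℕ → Carrier) → Carrier
  ∑ℕ k f = ∑[ j < k ] f (toℕ j)

  ∑ℕ-cong : ∀ k {f g : ℕ → Carrier} → (∀ j → j < k → f j ≈ g j) → ∑ℕ k f ≈ ∑ℕ k g
  ∑ℕ-cong k f≈g = sum-cong-≋ (λ j → f≈g (toℕ j) (toℕ<n j))

  ∑ℕ-last : ∀ k (f : ℕ → Carrier) → ∑ℕ (suc k) f ≈ ∑ℕ k f + f k
  ∑ℕ-last k f = trans (sum-init-last {k} (f ∘ toℕ))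
    (+-cong (sum-cong-≋ {k} λ j → reflexive (≡.cong f (toℕ-inject₁ j)))
            (reflexive (≡.cong f (toℕ-fromℕ k))))

module Determinant {c ℓ} (R : Ring c ℓ) where
  open Ring R hiding (zero)
  open Sym R
  open Scalars R using (sgn-central)
  open Sums R
  open import Algebra.Properties.Semiring.Sum semiring
  open import Algebra.Properties.Ring R using (-‿distribˡ-*; -1*x≈-x; x[y-z]≈xy-xz)
  open import Algebra.Properties.AbelianGroup +-abelianGroup using (⁻¹-∙-comm)
  open import Algebra.Properties.Group +-group using (ε⁻¹≈ε)
  open import Relation.Binary.Reasoning.Setoid setoid

  minorMatrix : ℕ → Matrix Carrier → Matrix Carrier
  minorMatrix j A r c = A (suc r) (punchInℕ j c)

  -- The determinant of the top-left k × k block, expanded along the first row exactly as det.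
  detℕ : ℕ → Matrix Carrier → Carrier
  detℕ zero    A = 1#
  detℕ (suc k) A = ∑ℕ (suc k) (λ j → sgn j * (A 0 j * detℕ k (minorMatrix j A)))

  detℕ-cong : ∀ k {A B : Matrix Carrier} → (∀ r c → r < k → c < k → A r c ≈ B r c) →
              detℕ k A ≈ detℕ k B
  detℕ-cong zero    _   = refl
  detℕ-cong (suc k) A≈B = ∑ℕ-cong (suc k) λ j j<1+k →
    *-congˡ {sgn j} (*-cong (A≈B 0 j (s≤s z≤n) j<1+k) (detℕ-cong k λ r c r<k c<k →
      A≈B (suc r) _ (s≤s r<k) (s≤s (≤-trans (punchInℕ-≤ j c) c<k))))

  det≈detℕ : ∀ {n} (M : Fin n → Fin n → Carrier) (A : Matrix Carrier) →
             (∀ i j → M i j ≈ A (toℕ i) (toℕ j)) → det M ≈ detℕ n A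
  det≈detℕ {zero}  M A M≈A = refl
  det≈detℕ {suc n} M A M≈A =
    trans (sumF≈sum λ j → sgn (toℕ j) * (M zero j * det (λ i k → M (suc i) (punchIn j k))))
      (sum-cong-≋ {suc n} λ j → *-congˡ {sgn (toℕ j)} (*-cong (M≈A zero j)
        (det≈detℕ _ (minorMatrix (toℕ j) A) λ i k →
          trans (M≈A (suc i) (punchIn j k)) (reflexive (≡.cong (A (suc (toℕ i))) (toℕ-punchIn j k))))))

  detℕ-1 : ∀ A → detℕ 1 A ≈ A 0 0
  detℕ-1 A = trans (+-identityʳ _) (trans (*-identityˡ _) (*-identityʳ _))

  detℕ-∷-cong : ∀ n {u v : ℕ → Carrier} B → (∀ c → u c ≈ v c) →
                detℕ (suc n) (u ∷ B) ≈ detℕ (suc n) (v ∷ B)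
  detℕ-∷-cong n {u} {v} B u≈v = detℕ-cong (suc n) {u ∷ B} {v ∷ B} λ
    { zero    c _ _ → u≈v c
    ; (suc r) c _ _ → refl
    }

  detℕ-∷-+ : ∀ n (u v : ℕ → Carrier) B →
    detℕ (suc n) ((λ c → u c + v c) ∷ B) ≈ detℕ (suc n) (u ∷ B) + detℕ (suc n) (v ∷ B)
  detℕ-∷-+ n u v B =
    trans (∑ℕ-cong (suc n) λ j _ → split j) (∑-distrib-+ {suc n} (term u ∘ toℕ) (term v ∘ toℕ))
    where
    X : ℕ → Carrier
    X j = detℕ n (minorMatrix j (u ∷ B))
    term : (ℕ → Carrier) → ℕ → Carrier
    term v j = sgn j * (v j * X j)
    split : ∀ j → sgn j * ((u j + v j) * X j) ≈ term u j + term v j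
    split j = trans (*-congˡ (distribʳ (X j) (u j) (v j))) (distribˡ (sgn j) _ _)

  detℕ-∷-*ˡ : ∀ n a (v : ℕ → Carrier) B →
              detℕ (suc n) ((λ c → a * v c) ∷ B) ≈ a * detℕ (suc n) (v ∷ B)
  detℕ-∷-*ˡ n a v B = trans (∑ℕ-cong (suc n) λ j _ → pull j (X j))
    (sym (*-distribˡ-sum {suc n} a λ j → sgn (toℕ j) * (v (toℕ j) * X (toℕ j))))
    where
    X : ℕ → Carrier
    X j = detℕ n (minorMatrix j (v ∷ B))
    pull : ∀ j Y → sgn j * ((a * v j) * Y) ≈ a * (sgn j * (v j * Y))
    pull j Y = begin
      sgn j * ((a * v j) * Y) ≈⟨ *-congˡ (*-assoc a (v j) Y) ⟩
      sgn j * (a * (v j * Y)) ≈⟨ *-assoc (sgn j) a _ ⟨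
      (sgn j * a) * (v j * Y) ≈⟨ *-congʳ (sgn-central j a) ⟩
      (a * sgn j) * (v j * Y) ≈⟨ *-assoc a (sgn j) _ ⟩
      a * (sgn j * (v j * Y)) ∎

  detℕ-∷-∑ : ∀ n {m} (θ : Fin m → Carrier) (w : Fin m → ℕ → Carrier) B →
    detℕ (suc n) ((λ c → ∑[ i < m ] (θ i * w i c)) ∷ B) ≈ ∑[ i < m ] (θ i * detℕ (suc n) (w i ∷ B))
  detℕ-∷-∑ n {zero}  θ w B =
    ∑-zero {suc n} (λ j → sgn (toℕ j) * (0# * detℕ n (minorMatrix (toℕ j) ((λ _ → 0#) ∷ B))))
      λ j → trans (*-congˡ (zeroˡ _)) (zeroʳ _)
  detℕ-∷-∑ n {suc m} θ w B = begin
    detℕ (suc n) ((λ c → head c + tail c) ∷ B)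
      ≈⟨ detℕ-∷-+ n head tail B ⟩
    detℕ (suc n) (head ∷ B) + detℕ (suc n) (tail ∷ B)
      ≈⟨ +-cong (detℕ-∷-*ˡ n (θ zero) (w zero) B) (detℕ-∷-∑ n (θ ∘ suc) (w ∘ suc) B) ⟩
    θ zero * detℕ (suc n) (w zero ∷ B) + ∑[ i < m ] (θ (suc i) * detℕ (suc n) (w (suc i) ∷ B)) ∎
    where
    head tail : ℕ → Carrier
    head c = θ zero * w zero c
    tail c = ∑[ i < m ] (θ (suc i) * w (suc i) c)

  detℕ-column₀ : ∀ k (A : Matrix Carrier) → (∀ r → A (suc r) 0 ≈ 0#) →
    detℕ (suc k) A ≈ A 0 0 * detℕ k (minorMatrix 0 A)
  detℕ-column₀ zero    A _    = trans (+-identityʳ _) (*-identityˡ _)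
  detℕ-column₀ (suc k) A A₀≈0 =
    trans (+-cong (*-identityˡ _) (∑-zero {suc k} (term ∘ toℕ) (vanish ∘ toℕ))) (+-identityʳ _)
    where
    term : ℕ → Carrier
    term j = sgn (suc j) * (A 0 (suc j) * detℕ (suc k) (minorMatrix (suc j) A))
    vanish : ∀ j → term j ≈ 0#
    vanish j = begin
      sgn (suc j) * (A 0 (suc j) * detℕ (suc k) (minorMatrix (suc j) A))
        ≈⟨ *-congˡ (*-congˡ (detℕ-column₀ k (minorMatrix (suc j) A) (A₀≈0 ∘ suc))) ⟩
      sgn (suc j) * (A 0 (suc j) * (A 1 0 * detℕ k (minorMatrix 0 (minorMatrix (suc j) A))))
        ≈⟨ *-congˡ (*-congˡ (trans (*-congʳ (A₀≈0 0)) (zeroˡ _))) ⟩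
      sgn (suc j) * (A 0 (suc j) * 0#)
        ≈⟨ trans (*-congˡ (zeroʳ _)) (zeroʳ _) ⟩
      0# ∎

  setColumn : ℕ → (ℕ → Carrier) → Matrix Carrier → Matrix Carrier
  setColumn k w A r c = if c ≡ᵇ k then w r else A r c

  setColumn-≡ : ∀ k w A r → setColumn k w A r k ≡ w r
  setColumn-≡ k w A r = ≡.cong (λ b → if b then w r else A r k) (dec-true (k ≟ k) ≡.refl)

  setColumn-< : ∀ {k c} w A r → c < k → setColumn k w A r c ≡ A r c
  setColumn-< {k} {c} w A r c<k = ≡.cong (λ b → if b then w r else A r c) (dec-false (c ≟ k) (<⇒≢ c<k))

  setColumn-self : ∀ k A r c → setColumn k (λ r → A r k) A r c ≡ A r c
  setColumn-self k A r c with c ≟ k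
  ... | yes ≡.refl = setColumn-≡ k (λ r → A r k) A r
  ... | no c≢k     = ≡.cong (λ b → if b then A r k else A r c) (dec-false (c ≟ k) c≢k)

  minorMatrix-setColumn : ∀ {j k} w A r c → j ≤ k →
    minorMatrix j (setColumn (suc k) w A) r c ≡ setColumn k (w ∘ suc) (minorMatrix j A) r c
  minorMatrix-setColumn {j} w A r c j≤k =
    ≡.cong (λ b → if b then w (suc r) else A (suc r) (punchInℕ j c)) (punchInℕ-≡ᵇ c j≤k)

  minorMatrix-setColumn-< : ∀ {j j′ k c} w A r → c < j → c < j′ → c < k →
    minorMatrix j (setColumn k w A) r c ≡ minorMatrix j′ A r c
  minorMatrix-setColumn-< {k = k} w A r c<j c<j′ c<k =
    ≡.trans (≡.cong (setColumn k w A (suc r)) (punchInℕ-< c<j))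
      (≡.trans (setColumn-< w A (suc r) c<k) (≡.cong (A (suc r)) (≡.sym (punchInℕ-< c<j′))))

  -- Expansion along the last row of the left-hand matrix, whose only entries that need not vanish
  -- are A (suc k) k and w (suc k).
  detℕ-setColumn : ∀ k (A : Matrix Carrier) w → (∀ c → c < k → A (suc k) c ≈ 0#) →
    detℕ (suc (suc k)) (setColumn (suc k) w A)
      ≈ detℕ (suc k) A * w (suc k) - detℕ (suc k) (setColumn k w A) * A (suc k) k
  detℕ-setColumn zero A w _ = begin
    sgn 0 * (A 0 0 * detℕ 1 (minorMatrix 0 A′)) + (sgn 1 * (w 0 * detℕ 1 (minorMatrix 1 A′)) + 0#)
      ≈⟨ +-cong (*-identityˡ _) (trans (+-identityʳ _) (-1*x≈-x _)) ⟩
    A 0 0 * detℕ 1 (minorMatrix 0 A′) - w 0 * detℕ 1 (minorMatrix 1 A′)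
      ≈⟨ +-cong (*-congˡ (detℕ-1 (minorMatrix 0 A′)))
                (-‿cong (*-congˡ (detℕ-1 (minorMatrix 1 A′)))) ⟩
    A 0 0 * w 1 - w 0 * A 1 0
      ≈⟨ +-cong (*-congʳ (detℕ-1 A)) (-‿cong (*-congʳ (detℕ-1 (setColumn 0 w A)))) ⟨
    detℕ 1 A * w 1 - detℕ 1 (setColumn 0 w A) * A 1 0 ∎
    where
    A′ = setColumn 1 w A
  detℕ-setColumn (suc k) A w A₁≈0 = begin
    detℕ (suc (suc K)) A′
      ≈⟨ ∑ℕ-last (suc K) T ⟩
    ∑ℕ (suc K) T + T (suc K)
      ≈⟨ +-cong (∑ℕ-cong (suc K) λ j j<1+K → front j (s≤s⁻¹ j<1+K)) last ⟩
    ∑ℕ (suc K) (λ j → P j * w (suc K) - Q j * b j) + - (Z * a)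
      ≈⟨ +-congʳ (trans (∑-distrib-sub {suc K} (λ j → P (toℕ j) * w (suc K))
                                               (λ j → Q (toℕ j) * b (toℕ j)))
                        (+-cong (sym (*-distribʳ-sum {suc K} (w (suc K)) (P ∘ toℕ)))
                                (-‿cong rearranged))) ⟩
    (detℕ (suc K) A * w (suc K) - ∑ℕ K Q * a) + - (Z * a)
      ≈⟨ +-assoc _ _ _ ⟩
    detℕ (suc K) A * w (suc K) + (- (∑ℕ K Q * a) + - (Z * a))
      ≈⟨ +-congˡ (trans (⁻¹-∙-comm _ _) (-‿cong (sym (distribʳ a _ _)))) ⟩
    detℕ (suc K) A * w (suc K) - (∑ℕ K Q + Z) * a
      ≈⟨ +-congˡ (-‿cong (*-congʳ (sym lastColumnReplaced))) ⟩
    detℕ (suc K) A * w (suc K) - detℕ (suc K) (setColumn K w A) * a ∎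
    where
    K = suc k
    a = A (suc K) K
    A′ = setColumn (suc K) w A
    T P Q b : ℕ → Carrier
    T j = sgn j * (A′ 0 j * detℕ (suc K) (minorMatrix j A′))
    P j = sgn j * (A 0 j * detℕ K (minorMatrix j A))
    Q j = sgn j * (A 0 j * detℕ K (setColumn k (w ∘ suc) (minorMatrix j A)))
    b j = A (suc K) (punchInℕ j k)
    F = detℕ K (minorMatrix (suc K) A)
    Z = sgn K * (w 0 * F)

    hessenberg : ∀ j c → c < k → minorMatrix j A K c ≈ 0#
    hessenberg j c c<k = A₁≈0 (punchInℕ j c) (s≤s (≤-trans (punchInℕ-≤ j c) c<k))

    front : ∀ j → j ≤ K → T j ≈ P j * w (suc K) - Q j * b j
    front j j≤K = begin
      T j
        ≈⟨ *-congˡ (*-cong (reflexive (setColumn-< w A 0 (s≤s j≤K)))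
                     (detℕ-cong (suc K) λ r c _ _ → reflexive (minorMatrix-setColumn w A r c j≤K))) ⟩
      sgn j * (A 0 j * detℕ (suc K) (setColumn K (w ∘ suc) (minorMatrix j A)))
        ≈⟨ *-congˡ (*-congˡ (detℕ-setColumn k (minorMatrix j A) (w ∘ suc) (hessenberg j))) ⟩
      sgn j * (A 0 j * (D * w (suc K) - E * b j))
        ≈⟨ trans (*-congˡ (x[y-z]≈xy-xz (A 0 j) _ _)) (x[y-z]≈xy-xz (sgn j) _ _) ⟩
      sgn j * (A 0 j * (D * w (suc K))) - sgn j * (A 0 j * (E * b j))
        ≈⟨ +-cong (reassoc _ _ _ _) (-‿cong (reassoc _ _ _ _)) ⟩
      P j * w (suc K) - Q j * b j ∎
      where
      D = detℕ K (minorMatrix j A)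
      E = detℕ K (setColumn k (w ∘ suc) (minorMatrix j A))
      reassoc : ∀ s u x y → s * (u * (x * y)) ≈ (s * (u * x)) * y
      reassoc s u x y = trans (*-congˡ (sym (*-assoc u x y))) (sym (*-assoc s _ y))

    lastMinor : detℕ (suc K) (minorMatrix (suc K) A) ≈ F * a
    lastMinor = begin
      detℕ (suc K) M
        ≈⟨ detℕ-cong (suc K) (λ r c _ _ → reflexive (≡.sym (setColumn-self K M r c))) ⟩
      detℕ (suc K) (setColumn K (λ r → M r K) M)
        ≈⟨ detℕ-setColumn k M (λ r → M r K) (hessenberg (suc K)) ⟩
      F * M K K - detℕ K (setColumn k (λ r → M r K) M) * M K k
        ≈⟨ +-cong (*-congˡ (reflexive (≡.cong (A (suc K)) (punchInℕ-< (n<1+n K)))))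
                  (-‿cong (trans (*-congˡ M[K,k]≈0) (zeroʳ _))) ⟩
      F * a - 0#
        ≈⟨ trans (+-congˡ ε⁻¹≈ε) (+-identityʳ _) ⟩
      F * a ∎
      where
      M = minorMatrix (suc K) A
      M[K,k]≈0 : M K k ≈ 0#
      M[K,k]≈0 = trans (reflexive (≡.cong (A (suc K)) (punchInℕ-< (≤-trans (n<1+n k) (n≤1+n K)))))
                       (A₁≈0 k (n<1+n k))

    last : T (suc K) ≈ - (Z * a)
    last = begin
      - sgn K * (A′ 0 (suc K) * detℕ (suc K) (minorMatrix (suc K) A′))
        ≈⟨ *-congˡ (*-cong (reflexive (setColumn-≡ (suc K) w A 0))
             (trans (detℕ-cong (suc K) λ r c _ c<1+K →
                      reflexive (minorMatrix-setColumn-< w A r c<1+K c<1+K c<1+K))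
                    lastMinor)) ⟩
      - sgn K * (w 0 * (F * a))
        ≈⟨ -‿distribˡ-* (sgn K) _ ⟨
      - (sgn K * (w 0 * (F * a)))
        ≈⟨ -‿cong (trans (*-congˡ (sym (*-assoc (w 0) F a))) (sym (*-assoc (sgn K) _ a))) ⟩
      - (Z * a) ∎

    rearranged : ∑ℕ (suc K) (λ j → Q j * b j) ≈ ∑ℕ K Q * a
    rearranged = begin
      ∑ℕ (suc K) (λ j → Q j * b j)
        ≈⟨ ∑ℕ-last K (λ j → Q j * b j) ⟩
      ∑ℕ K (λ j → Q j * b j) + Q K * b K
        ≈⟨ +-cong (∑ℕ-cong K λ j j<K →
                     *-congˡ {Q j} (reflexive (≡.cong (A (suc K)) (punchInℕ-≥ (s≤s⁻¹ j<K)))))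
                  (trans (*-congˡ (trans (reflexive (≡.cong (A (suc K)) (punchInℕ-< (n<1+n k))))
                                         (A₁≈0 k (n<1+n k))))
                         (zeroʳ _)) ⟩
      ∑ℕ K (λ j → Q j * a) + 0#
        ≈⟨ trans (+-identityʳ _) (sym (*-distribʳ-sum {K} a (Q ∘ toℕ))) ⟩
      ∑ℕ K Q * a ∎

    lastColumnReplaced : detℕ (suc K) (setColumn K w A) ≈ ∑ℕ K Q + Z
    lastColumnReplaced = begin
      detℕ (suc K) A″
        ≈⟨ ∑ℕ-last K U ⟩
      ∑ℕ K U + U K
        ≈⟨ +-cong (∑ℕ-cong K λ j j<K → *-congˡ {sgn j} (*-cong (reflexive (setColumn-< w A 0 j<K))
                     (detℕ-cong K λ r c _ _ → reflexive (minorMatrix-setColumn w A r c (s≤s⁻¹ j<K)))))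
                  (*-congˡ (*-cong (reflexive (setColumn-≡ K w A 0)) (detℕ-cong K λ r c _ c<K →
                     reflexive (minorMatrix-setColumn-< w A r c<K (≤-trans c<K (n≤1+n K)) c<K)))) ⟩
      ∑ℕ K Q + Z ∎
      where
      A″ = setColumn K w A
      U : ℕ → Carrier
      U j = sgn j * (A″ 0 j * detℕ K (minorMatrix j A″))

module Symmetric {c ℓ} (R : Ring c ℓ) where
  open Ring R hiding (zero)
  open Sym R
  open import Algebra.Properties.Semiring.Sum semiring
    using (sum-syntax; ∑-distrib-+; *-distribˡ-sum; sum-cong-≋)
  open import Relation.Binary.Reasoning.Setoid setoid

  e-zero : ∀ {N} (x : Fin N → Carrier) → e x 0 ≡ 1#
  e-zero {zero}  x = ≡.refl
  e-zero {suc N} x = ≡.refl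

  eWithout : ∀ {N} → (Fin N → Carrier) → Fin N → ℕ → Carrier
  eWithout {suc N} x i = e (removeAt x i)

  eWithout-zero : ∀ {N} (x : Fin N → Carrier) i → eWithout x i 0 ≡ 1#
  eWithout-zero {suc N} x i = e-zero (removeAt x i)

  eWithout-suc : ∀ {N} (x : Fin (suc N) → Carrier) i k →
    eWithout x (suc i) (suc k) ≡ x zero * eWithout (x ∘ suc) i k + eWithout (x ∘ suc) i (suc k)
  eWithout-suc {suc N} x i k = ≡.refl

  et≈∑θeWithout : ∀ {N} (x θ : Fin N → Carrier) → (∀ i a → x i * a ≈ a * x i) →
    ∀ k → et x θ k ≈ ∑[ i < N ] (θ i * eWithout x i k)
  et≈∑θeWithout {zero}  x θ _         k       = refl
  et≈∑θeWithout {suc N} x θ x-central zero    = +-cong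
    (sym (trans (*-congˡ (reflexive (e-zero (x ∘ suc)))) (*-identityʳ _)))
    (trans (et≈∑θeWithout (x ∘ suc) (θ ∘ suc) (x-central ∘ suc) 0) (sum-cong-≋ {N} λ i →
      *-congˡ (reflexive (≡.trans (eWithout-zero (x ∘ suc) i) (≡.sym (eWithout-zero x (suc i)))))))
  et≈∑θeWithout {suc N} x θ x-central (suc k) = begin
    θ zero * e x′ (suc k) + x zero * et x′ θ′ k + et x′ θ′ (suc k)
      ≈⟨ +-assoc _ _ _ ⟩
    θ zero * e x′ (suc k) + (x zero * et x′ θ′ k + et x′ θ′ (suc k))
      ≈⟨ +-congˡ (+-cong (*-congˡ (et≈∑θeWithout x′ θ′ (x-central ∘ suc) k))
                         (et≈∑θeWithout x′ θ′ (x-central ∘ suc) (suc k))) ⟩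
    θ zero * e x′ (suc k) + (x zero * ∑[ i < N ] (θ′ i * ε i k) + ∑[ i < N ] (θ′ i * ε i (suc k)))
      ≈⟨ +-congˡ (+-congʳ (*-distribˡ-sum (x zero) λ i → θ′ i * ε i k)) ⟩
    θ zero * e x′ (suc k) + (∑[ i < N ] (x zero * (θ′ i * ε i k)) + ∑[ i < N ] (θ′ i * ε i (suc k)))
      ≈⟨ +-congˡ (∑-distrib-+ (λ i → x zero * (θ′ i * ε i k)) (λ i → θ′ i * ε i (suc k))) ⟨
    θ zero * e x′ (suc k) + ∑[ i < N ] (x zero * (θ′ i * ε i k) + θ′ i * ε i (suc k))
      ≈⟨ +-congˡ (sum-cong-≋ {N} λ i → trans (+-congʳ (commute i)) (sym (distribˡ (θ′ i) _ _))) ⟩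
    θ zero * e x′ (suc k) + ∑[ i < N ] (θ′ i * (x zero * ε i k + ε i (suc k)))
      ≈⟨ +-congˡ (sum-cong-≋ {N} λ i → *-congˡ (reflexive (≡.sym (eWithout-suc x i k)))) ⟩
    θ zero * e x′ (suc k) + ∑[ i < N ] (θ′ i * eWithout x (suc i) (suc k)) ∎
    where
    x′ θ′ : Fin N → Carrier
    x′ = x ∘ suc
    θ′ = θ ∘ suc
    ε : Fin N → ℕ → Carrier
    ε = eWithout x′
    commute : ∀ i → x zero * (θ′ i * ε i k) ≈ θ′ i * (x zero * ε i k)
    commute i = begin
      x zero * (θ′ i * ε i k)  ≈⟨ *-assoc _ _ _ ⟨
      (x zero * θ′ i) * ε i k  ≈⟨ *-congʳ (x-central zero (θ′ i)) ⟩
      (θ′ i * x zero) * ε i k  ≈⟨ *-assoc _ _ _ ⟩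
      θ′ i * (x zero * ε i k)  ∎

  band-suc : ∀ f r c → band f (suc r) (suc c) ≡ band f r c
  band-suc f zero    c = ≡.refl
  band-suc f (suc r) c = ≡.refl

  bandD-suc : ∀ f d r c → bandD f d (suc r) (suc c) ≡ bandD f d r c
  bandD-suc f d zero    c = ≡.refl
  bandD-suc f d (suc r) c = ≡.refl

  bandD-diagonal : ∀ f d k → bandD f d k k ≡ d
  bandD-diagonal f d zero    = ≡.refl
  bandD-diagonal f d (suc k) = ≡.trans (bandD-suc f d k k) (bandD-diagonal f d k)

  bandD-below : ∀ f d {r c} → c < r → bandD f d r c ≡ 0#
  bandD-below f d {suc r} {zero}  _         = ≡.refl
  bandD-below f d {suc r} {suc c} (s≤s c<r) = ≡.trans (bandD-suc f d r c) (bandD-below f d c<r)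

  bandD-above : ∀ f d {r c} → r < c → bandD f d r c ≡ f (c ∸ r)
  bandD-above f d {zero}  {suc c} _         = ≡.refl
  bandD-above f d {suc r} {suc c} (s≤s r<c) = ≡.trans (bandD-suc f d r c) (bandD-above f d r<c)

  Mepℕ : ∀ {N} → (Fin N → Carrier) → Matrix Carrier
  Mepℕ x = (p x ∘ suc) ∷ λ r → bandD (p x) (fromℕ (suc r)) r

  Mept-rows : ∀ {N} → (Fin N → Carrier) → ℕ → Matrix Carrier
  Mept-rows x n r = bandD (p x) (fromℕ (n ∸ r)) r

  Mepℕ-column : ∀ {N} (x : Fin N → Carrier) {c k} → c ≤ k → Mepℕ x c k ≡ p x (suc k ∸ c)
  Mepℕ-column x {zero}  _   = ≡.refl
  Mepℕ-column x {suc c} c<k = bandD-above (p x) _ c<k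

module Bosonic {c ℓ} (S : CommutativeRing c ℓ) where
  open CommutativeRing S hiding (zero)
  open Sym ring
  open Scalars ring using (sgn-sgn; fromℕ-*)
  open Sums ring
  open Determinant ring
  open Symmetric ring
  open import Algebra.Properties.Semiring.Sum semiring
  open import Algebra.Properties.Ring ring using (-‿distribˡ-*; x[y-z]≈xy-xz)
  open import Algebra.Properties.CommutativeSemigroup *-commutativeSemigroup using (x∙yz≈y∙xz; x∙yz≈yx∙z)
  open import Algebra.Properties.CommutativeSemigroup +-commutativeSemigroup
    using () renaming (interchange to +-interchange)
  open import Algebra.Properties.AbelianGroup +-abelianGroup using (xyx⁻¹≈y)
  open import Relation.Binary.Reasoning.Setoid setoid

  x+y-y≈x : ∀ x y → x + y - y ≈ x
  x+y-y≈x x y = trans (+-assoc x y (- y)) (trans (+-congˡ (-‿inverseʳ y)) (+-identityʳ x))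

  x[y[zw]]≈z[x[yw]] : ∀ x y z w → x * (y * (z * w)) ≈ z * (x * (y * w))
  x[y[zw]]≈z[x[yw]] x y z w = trans (*-congˡ (x∙yz≈y∙xz y z w)) (x∙yz≈y∙xz x z _)

  detℕ-column₀₁ : ∀ k (A : Matrix Carrier) → (∀ r → A (suc (suc r)) 0 ≈ 0#) →
    detℕ (suc (suc k)) A ≈ A 0 0 * detℕ (suc k) (minorMatrix 0 A)
                          - A 1 0 * detℕ (suc k) ((A 0 ∘ suc) ∷ λ r c → A (suc (suc r)) (suc c))
  detℕ-column₀₁ k A A₂≈0 = begin
    sgn 0 * (A 0 0 * detℕ (suc k) (minorMatrix 0 A)) + ∑ℕ (suc k) T
      ≈⟨ +-cong (*-identityˡ _) (∑ℕ-cong (suc k) λ j _ → expand j) ⟩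
    A 0 0 * detℕ (suc k) (minorMatrix 0 A) + ∑ℕ (suc k) (λ j → - (A 1 0 * Y j))
      ≈⟨ +-congˡ (trans (-‿cong (*-distribˡ-sum {suc k} (A 1 0) (Y ∘ toℕ)))
                        (∑-neg {suc k} (λ j → A 1 0 * Y (toℕ j)))) ⟨
    A 0 0 * detℕ (suc k) (minorMatrix 0 A) - A 1 0 * ∑ℕ (suc k) Y ∎
    where
    B : Matrix Carrier
    B = (A 0 ∘ suc) ∷ λ r c → A (suc (suc r)) (suc c)
    T Y : ℕ → Carrier
    T j = sgn (suc j) * (A 0 (suc j) * detℕ (suc k) (minorMatrix (suc j) A))
    Y j = sgn j * (A 0 (suc j) * detℕ k (minorMatrix j B))
    expand : ∀ j → T j ≈ - (A 1 0 * Y j)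
    expand j = begin
      - sgn j * (A 0 (suc j) * detℕ (suc k) (minorMatrix (suc j) A))
        ≈⟨ *-congˡ (*-congˡ (detℕ-column₀ k (minorMatrix (suc j) A) A₂≈0)) ⟩
      - sgn j * (A 0 (suc j) * (A 1 0 * detℕ k (minorMatrix j B)))
        ≈⟨ -‿distribˡ-* (sgn j) _ ⟨
      - (sgn j * (A 0 (suc j) * (A 1 0 * detℕ k (minorMatrix j B))))
        ≈⟨ -‿cong (x[y[zw]]≈z[x[yw]] (sgn j) (A 0 (suc j)) (A 1 0) _) ⟩
      - (A 1 0 * Y j) ∎

  e-split : ∀ {N} (x : Fin N → Carrier) i k → e x (suc k) ≈ eWithout x i (suc k) + x i * eWithout x i k
  e-split {suc N} x zero    k       = +-comm _ _
  e-split {suc N} x (suc i) zero    = begin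
    x zero * e x′ 0 + e x′ 1
      ≈⟨ +-congˡ (e-split x′ i 0) ⟩
    x zero * e x′ 0 + (eWithout x′ i 1 + x′ i * eWithout x′ i 0)
      ≈⟨ +-assoc _ _ _ ⟨
    (x zero * e x′ 0 + eWithout x′ i 1) + x′ i * eWithout x′ i 0
      ≈⟨ +-cong (+-congʳ (*-congˡ (reflexive (≡.trans (e-zero x′) (≡.sym (eWithout-zero x′ i))))))
                (*-congˡ (reflexive (≡.trans (eWithout-zero x′ i) (≡.sym (eWithout-zero x (suc i)))))) ⟩
    (x zero * eWithout x′ i 0 + eWithout x′ i 1) + x′ i * eWithout x (suc i) 0
      ≈⟨ +-congʳ (reflexive (≡.sym (eWithout-suc x i 0))) ⟩
    eWithout x (suc i) 1 + x′ i * eWithout x (suc i) 0 ∎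
    where
    x′ : Fin N → Carrier
    x′ = x ∘ suc
  e-split {suc N} x (suc i) (suc k) = begin
    x zero * e x′ (suc k) + e x′ (suc (suc k))
      ≈⟨ +-cong (*-congˡ (e-split x′ i k)) (e-split x′ i (suc k)) ⟩
    x zero * (ε (suc k) + y * ε k) + (ε (suc (suc k)) + y * ε (suc k))
      ≈⟨ +-congʳ (distribˡ (x zero) _ _) ⟩
    (x zero * ε (suc k) + x zero * (y * ε k)) + (ε (suc (suc k)) + y * ε (suc k))
      ≈⟨ +-interchange _ _ _ _ ⟩
    (x zero * ε (suc k) + ε (suc (suc k))) + (x zero * (y * ε k) + y * ε (suc k))
      ≈⟨ +-congˡ (trans (+-congʳ (x∙yz≈y∙xz (x zero) y (ε k))) (sym (distribˡ y _ _))) ⟩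
    (x zero * ε (suc k) + ε (suc (suc k))) + y * (x zero * ε k + ε (suc k))
      ≈⟨ +-cong (reflexive (≡.sym (eWithout-suc x i (suc k))))
                (*-congˡ (reflexive (≡.sym (eWithout-suc x i k)))) ⟩
    eWithout x (suc i) (suc (suc k)) + y * eWithout x (suc i) (suc k) ∎
    where
    x′ : Fin N → Carrier
    x′ = x ∘ suc
    y = x (suc i)
    ε = eWithout x′ i

  ∑x-eWithout : ∀ {N} (x : Fin N → Carrier) k →
                ∑[ i < N ] (x i * eWithout x i k) ≈ fromℕ (suc k) * e x (suc k)
  ∑x-eWithout {zero}  x k    = sym (zeroʳ _)
  ∑x-eWithout {suc N} x zero = begin
    x zero * e x′ 0 + ∑[ i < N ] (x′ i * eWithout x (suc i) 0)
      ≈⟨ +-congˡ (trans (sum-cong-≋ {N} λ i →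
                           *-congˡ (reflexive (≡.trans (eWithout-zero x (suc i)) (≡.sym (eWithout-zero x′ i)))))
                        (∑x-eWithout x′ 0)) ⟩
    x zero * e x′ 0 + fromℕ 1 * e x′ 1
      ≈⟨ +-congˡ (trans (*-congʳ (+-identityʳ 1#)) (*-identityˡ _)) ⟩
    x zero * e x′ 0 + e x′ 1
      ≈⟨ trans (*-congʳ (+-identityʳ 1#)) (*-identityˡ _) ⟨
    fromℕ 1 * (x zero * e x′ 0 + e x′ 1) ∎
    where
    x′ : Fin N → Carrier
    x′ = x ∘ suc
  ∑x-eWithout {suc N} x (suc k) = begin
    x zero * E₁ + ∑[ i < N ] (x′ i * eWithout x (suc i) (suc k))
      ≈⟨ +-congˡ (sum-cong-≋ {N} λ i → trans (*-congˡ (reflexive (eWithout-suc x i k))) (spread i)) ⟩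
    x zero * E₁ + ∑[ i < N ] (x zero * (x′ i * ε i k) + x′ i * ε i (suc k))
      ≈⟨ +-congˡ (∑-distrib-+ (λ i → x zero * (x′ i * ε i k)) (λ i → x′ i * ε i (suc k))) ⟩
    x zero * E₁ + (∑[ i < N ] (x zero * (x′ i * ε i k)) + ∑[ i < N ] (x′ i * ε i (suc k)))
      ≈⟨ +-congˡ (+-congʳ (*-distribˡ-sum (x zero) (λ i → x′ i * ε i k))) ⟨
    x zero * E₁ + (x zero * ∑[ i < N ] (x′ i * ε i k) + ∑[ i < N ] (x′ i * ε i (suc k)))
      ≈⟨ +-congˡ (+-cong (*-congˡ (∑x-eWithout x′ k)) (∑x-eWithout x′ (suc k))) ⟩
    x zero * E₁ + (x zero * (K * E₁) + (1# + K) * E₂)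
      ≈⟨ +-assoc _ _ _ ⟨
    (x zero * E₁ + x zero * (K * E₁)) + (1# + K) * E₂
      ≈⟨ +-congʳ (trans (distribʳ (x zero * E₁) 1# K)
                        (+-cong (*-identityˡ _) (x∙yz≈y∙xz K (x zero) E₁))) ⟨
    (1# + K) * (x zero * E₁) + (1# + K) * E₂
      ≈⟨ distribˡ (1# + K) _ _ ⟨
    (1# + K) * (x zero * E₁ + E₂) ∎
    where
    x′ : Fin N → Carrier
    x′ = x ∘ suc
    ε = eWithout x′
    K = fromℕ (suc k)
    E₁ = e x′ (suc k)
    E₂ = e x′ (suc (suc k))
    spread : ∀ i → x′ i * (x zero * ε i k + ε i (suc k))
                   ≈ x zero * (x′ i * ε i k) + x′ i * ε i (suc k)
    spread i = trans (distribˡ (x′ i) _ _) (+-congʳ (x∙yz≈y∙xz (x′ i) (x zero) (ε i k)))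

  ∑sgn-e-pow : ∀ {N} (x : Fin N → Carrier) i k →
    ∑ℕ (suc k) (λ c → sgn c * (e x c * pow (x i) (k ∸ c))) ≈ sgn k * eWithout x i k
  ∑sgn-e-pow x i zero = begin
    1# * (e x 0 * 1#) + 0#
      ≈⟨ trans (+-identityʳ _) (trans (*-identityˡ _) (*-identityʳ _)) ⟩
    e x 0
      ≈⟨ reflexive (≡.trans (e-zero x) (≡.sym (eWithout-zero x i))) ⟩
    eWithout x i 0
      ≈⟨ *-identityˡ _ ⟨
    1# * eWithout x i 0 ∎
  ∑sgn-e-pow x i (suc k) = begin
    ∑ℕ (suc (suc k)) F
      ≈⟨ ∑ℕ-last (suc k) F ⟩
    ∑ℕ (suc k) F + F (suc k)
      ≈⟨ +-cong (∑ℕ-cong (suc k) λ c c<1+k → shift c (s≤s⁻¹ c<1+k)) top ⟩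
    ∑ℕ (suc k) (λ c → y * G c) + - sgn k * e x (suc k)
      ≈⟨ +-cong (*-distribˡ-sum {suc k} y (G ∘ toℕ)) (*-congˡ (sym (e-split x i k))) ⟨
    y * ∑ℕ (suc k) G + - sgn k * (ε (suc k) + y * ε k)
      ≈⟨ +-cong (*-congˡ (∑sgn-e-pow x i k)) (distribˡ (- sgn k) _ _) ⟩
    y * (sgn k * ε k) + (- sgn k * ε (suc k) + - sgn k * (y * ε k))
      ≈⟨ +-congˡ (+-congˡ (trans (sym (-‿distribˡ-* (sgn k) _))
                                 (-‿cong (x∙yz≈y∙xz (sgn k) y (ε k))))) ⟩
    y * (sgn k * ε k) + (- sgn k * ε (suc k) - y * (sgn k * ε k))
      ≈⟨ trans (sym (+-assoc _ _ _)) (xyx⁻¹≈y _ _) ⟩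
    - sgn k * ε (suc k) ∎
    where
    y = x i
    ε = eWithout x i
    F G : ℕ → Carrier
    F c = sgn c * (e x c * pow y (suc k ∸ c))
    G c = sgn c * (e x c * pow y (k ∸ c))
    shift : ∀ c → c ≤ k → F c ≈ y * G c
    shift c c≤k = trans (*-congˡ (*-congˡ (reflexive (≡.cong (pow y) (+-∸-assoc 1 c≤k)))))
                        (x[y[zw]]≈z[x[yw]] (sgn c) (e x c) y _)
    top : F (suc k) ≈ - sgn k * e x (suc k)
    top = *-congˡ (trans (*-congˡ (reflexive (≡.cong (pow y) (n∸n≡0 k)))) (*-identityʳ _))

  newton : ∀ {N} (x : Fin N → Carrier) k →
    ∑ℕ (suc k) (λ c → sgn c * (e x c * p x (suc k ∸ c))) ≈ sgn k * (fromℕ (suc k) * e x (suc k))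
  newton {N} x k = begin
    ∑ℕ (suc k) (λ c → sgn c * (e x c * p x (suc k ∸ c)))
      ≈⟨ ∑ℕ-cong (suc k) (λ c c<1+k → expand c (s≤s⁻¹ c<1+k)) ⟩
    ∑ℕ (suc k) (λ c → ∑[ i < N ] (x i * G i c))
      ≈⟨ ∑-comm {suc k} {N} (λ c i → x i * G i (toℕ c)) ⟩
    ∑[ i < N ] ∑ℕ (suc k) (λ c → x i * G i c)
      ≈⟨ sum-cong-≋ {N} (λ i → trans (sym (*-distribˡ-sum {suc k} (x i) (G i ∘ toℕ)))
                                     (*-congˡ (∑sgn-e-pow x i k))) ⟩
    ∑[ i < N ] (x i * (sgn k * eWithout x i k))
      ≈⟨ sum-cong-≋ {N} (λ i → x∙yz≈y∙xz (x i) (sgn k) _) ⟩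
    ∑[ i < N ] (sgn k * (x i * eWithout x i k))
      ≈⟨ *-distribˡ-sum (sgn k) (λ i → x i * eWithout x i k) ⟨
    sgn k * ∑[ i < N ] (x i * eWithout x i k)
      ≈⟨ *-congˡ (∑x-eWithout x k) ⟩
    sgn k * (fromℕ (suc k) * e x (suc k)) ∎
    where
    G : Fin N → ℕ → Carrier
    G i c = sgn c * (e x c * pow (x i) (k ∸ c))
    expand : ∀ c → c ≤ k → sgn c * (e x c * p x (suc k ∸ c)) ≈ ∑[ i < N ] (x i * G i c)
    expand c c≤k = begin
      sgn c * (e x c * p x (suc k ∸ c))
        ≈⟨ *-congˡ (*-congˡ (trans (reflexive (≡.cong (p x) (+-∸-assoc 1 c≤k)))
                                   (sumF≈sum λ i → x i * pow (x i) (k ∸ c)))) ⟩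
      sgn c * (e x c * ∑[ i < N ] (x i * pow (x i) (k ∸ c)))
        ≈⟨ *-congˡ (*-distribˡ-sum (e x c) λ i → x i * pow (x i) (k ∸ c)) ⟩
      sgn c * ∑[ i < N ] (e x c * (x i * pow (x i) (k ∸ c)))
        ≈⟨ *-distribˡ-sum (sgn c) (λ i → e x c * (x i * pow (x i) (k ∸ c))) ⟩
      ∑[ i < N ] (sgn c * (e x c * (x i * pow (x i) (k ∸ c))))
        ≈⟨ sum-cong-≋ {N} (λ i → x[y[zw]]≈z[x[yw]] (sgn c) (e x c) (x i) _) ⟩
      ∑[ i < N ] (x i * G i c) ∎

  detℕ-Mepℕ-setColumn : ∀ {N} (x : Fin N → Carrier) k w →
    detℕ (suc k) (setColumn k w (Mepℕ x))
      ≈ fromℕ (k !) * (sgn k * ∑ℕ (suc k) (λ c → sgn c * (e x c * w c)))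
  detℕ-Mepℕ : ∀ {N} (x : Fin N → Carrier) k →
    detℕ (suc k) (Mepℕ x) ≈ fromℕ (k !) * (fromℕ (suc k) * e x (suc k))

  detℕ-Mepℕ-setColumn x zero w = begin
    detℕ 1 (setColumn 0 w (Mepℕ x))
      ≈⟨ detℕ-1 (setColumn 0 w (Mepℕ x)) ⟩
    w 0
      ≈⟨ trans (*-congʳ (+-identityʳ 1#)) (trans (*-identityˡ _) (trans (*-identityˡ _) (trans (+-identityʳ _)
           (trans (*-identityˡ _) (trans (*-congʳ (reflexive (e-zero x))) (*-identityˡ _)))))) ⟨
    fromℕ 1 * (1# * (1# * (e x 0 * w 0) + 0#)) ∎
  detℕ-Mepℕ-setColumn x (suc k) w = begin
    detℕ (suc (suc k)) (setColumn (suc k) w (Mepℕ x))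
      ≈⟨ detℕ-setColumn k (Mepℕ x) w (λ c c<k → reflexive (bandD-below (p x) _ c<k)) ⟩
    detℕ (suc k) (Mepℕ x) * W - detℕ (suc k) (setColumn k w (Mepℕ x)) * Mepℕ x (suc k) k
      ≈⟨ +-cong (*-congʳ (detℕ-Mepℕ x k))
                (-‿cong (*-cong (detℕ-Mepℕ-setColumn x k w) (reflexive (bandD-diagonal (p x) _ k)))) ⟩
    (F * (K * E)) * W - (F * (s * Sₖ)) * K
      ≈⟨ +-cong (trans (*-congʳ (x∙yz≈yx∙z F K E)) (*-assoc _ _ _))
                (-‿cong (trans (*-comm _ K) (sym (*-assoc K F _)))) ⟩
    (K * F) * (E * W) - (K * F) * (s * Sₖ)
      ≈⟨ x[y-z]≈xy-xz (K * F) _ _ ⟨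
    (K * F) * (E * W - s * Sₖ)
      ≈⟨ *-cong (sym (fromℕ-* (suc k) (k !))) reorder ⟩
    fromℕ (suc k !) * (- s * (Sₖ + - s * (E * W)))
      ≈⟨ *-congˡ (*-congˡ (∑ℕ-last (suc k) λ c → sgn c * (e x c * w c))) ⟨
    fromℕ (suc k !) * (- s * ∑ℕ (suc (suc k)) (λ c → sgn c * (e x c * w c))) ∎
    where
    F = fromℕ (k !)
    K = fromℕ (suc k)
    E = e x (suc k)
    W = w (suc k)
    s = sgn k
    Sₖ = ∑ℕ (suc k) (λ c → sgn c * (e x c * w c))
    reorder : E * W - s * Sₖ ≈ - s * (Sₖ + - s * (E * W))
    reorder = begin
      E * W - s * Sₖ                      ≈⟨ +-comm _ _ ⟩
      - (s * Sₖ) + E * W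
        ≈⟨ +-cong (-‿distribˡ-* s Sₖ) (trans (sym (*-identityˡ _)) (*-congʳ (sym (sgn-sgn (suc k))))) ⟩
      - s * Sₖ + (- s * - s) * (E * W)    ≈⟨ +-congˡ (*-assoc _ _ _) ⟩
      - s * Sₖ + - s * (- s * (E * W))    ≈⟨ distribˡ (- s) _ _ ⟨
      - s * (Sₖ + - s * (E * W))          ∎

  detℕ-Mepℕ x k = begin
    detℕ (suc k) (Mepℕ x)
      ≈⟨ detℕ-cong (suc k) (λ r c _ _ → reflexive (≡.sym (setColumn-self k (Mepℕ x) r c))) ⟩
    detℕ (suc k) (setColumn k (λ r → Mepℕ x r k) (Mepℕ x))
      ≈⟨ detℕ-Mepℕ-setColumn x k (λ r → Mepℕ x r k) ⟩
    fromℕ (k !) * (sgn k * ∑ℕ (suc k) (λ c → sgn c * (e x c * Mepℕ x c k)))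
      ≈⟨ *-congˡ (*-congˡ (trans (∑ℕ-cong (suc k) λ c c<1+k →
                                     *-congˡ {sgn c} (*-congˡ {e x c}
                                       (reflexive (Mepℕ-column x (s≤s⁻¹ c<1+k)))))
                                  (newton x k))) ⟩
    fromℕ (k !) * (sgn k * (sgn k * (fromℕ (suc k) * e x (suc k))))
      ≈⟨ *-congˡ (trans (sym (*-assoc _ _ _)) (trans (*-congʳ (sgn-sgn k)) (*-identityˡ _))) ⟩
    fromℕ (k !) * (fromℕ (suc k) * e x (suc k)) ∎

  e≈detℕ-Mepℕ : ∀ {N} (x : Fin N → Carrier) m →
                fromℕ (suc m !) * e x (suc m) ≈ detℕ (suc m) (Mepℕ x)
  e≈detℕ-Mepℕ x m = begin
    fromℕ (suc m !) * e x (suc m)                   ≈⟨ *-congʳ (fromℕ-* (suc m) (m !)) ⟩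
    (fromℕ (suc m) * fromℕ (m !)) * e x (suc m)     ≈⟨ x∙yz≈yx∙z _ _ _ ⟨
    fromℕ (m !) * (fromℕ (suc m) * e x (suc m))     ≈⟨ detℕ-Mepℕ x m ⟨
    detℕ (suc m) (Mepℕ x)                           ∎


  detℕ-band-step : ∀ {N} (x : Fin N → Carrier) m v →
    detℕ (suc (suc m)) (v ∷ band (e x))
      ≈ v 0 * detℕ (suc m) ((e x ∘ suc) ∷ band (e x)) - detℕ (suc m) ((v ∘ suc) ∷ band (e x))
  detℕ-band-step x m v = begin
    detℕ (suc (suc m)) (v ∷ band (e x))
      ≈⟨ detℕ-column₀₁ m (v ∷ band (e x)) (λ _ → refl) ⟩
    v 0 * detℕ (suc m) (minorMatrix 0 (v ∷ band (e x)))
      - e x 0 * detℕ (suc m) ((v ∘ suc) ∷ λ r c → band (e x) (suc r) (suc c))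
      ≈⟨ +-cong (*-congˡ (detℕ-cong (suc m) (shifted {e x ∘ suc})))
                (-‿cong (trans (*-cong (reflexive (e-zero x)) (detℕ-cong (suc m) (shifted {v ∘ suc})))
                               (*-identityˡ _))) ⟩
    v 0 * detℕ (suc m) ((e x ∘ suc) ∷ band (e x)) - detℕ (suc m) ((v ∘ suc) ∷ band (e x)) ∎
    where
    shifted : ∀ {u : ℕ → Carrier} r c → r < suc m → c < suc m →
              (u ∷ λ r c → band (e x) (suc r) (suc c)) r c ≈ (u ∷ band (e x)) r c
    shifted zero    c _ _ = refl
    shifted (suc r) c _ _ = reflexive (band-suc (e x) r c)

  detℕ-eWithout : ∀ {N} (x : Fin N → Carrier) i m →
                  detℕ (suc m) (eWithout x i ∷ band (e x)) ≈ pow (x i) m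
  detℕ-eWithout x i zero    = trans (detℕ-1 (eWithout x i ∷ band (e x))) (reflexive (eWithout-zero x i))
  detℕ-eWithout x i (suc m) = begin
    detℕ (suc (suc m)) (ε ∷ B)
      ≈⟨ detℕ-band-step x m ε ⟩
    ε 0 * detℕ (suc m) ((e x ∘ suc) ∷ B) - detℕ (suc m) ((ε ∘ suc) ∷ B)
      ≈⟨ +-congʳ (trans (*-congʳ (reflexive (eWithout-zero x i))) (*-identityˡ _)) ⟩
    detℕ (suc m) ((e x ∘ suc) ∷ B) - detℕ (suc m) ((ε ∘ suc) ∷ B)
      ≈⟨ +-congʳ (trans (detℕ-∷-cong m B (e-split x i)) (detℕ-∷-+ m (ε ∘ suc) (λ c → y * ε c) B)) ⟩
    detℕ (suc m) ((ε ∘ suc) ∷ B) + detℕ (suc m) ((λ c → y * ε c) ∷ B)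
      - detℕ (suc m) ((ε ∘ suc) ∷ B)
      ≈⟨ xyx⁻¹≈y _ _ ⟩
    detℕ (suc m) ((λ c → y * ε c) ∷ B)
      ≈⟨ detℕ-∷-*ˡ m y ε B ⟩
    y * detℕ (suc m) (ε ∷ B)
      ≈⟨ *-congˡ (detℕ-eWithout x i m) ⟩
    y * pow y m ∎
    where
    y = x i
    ε = eWithout x i
    B = band (e x)

  p≈detℕ : ∀ {N} (x : Fin N → Carrier) m →
    p x (suc m) ≈ detℕ (suc m) ((λ c → fromℕ (suc c) * e x (suc c)) ∷ band (e x))
  p≈detℕ {N} x m = begin
    p x (suc m)
      ≈⟨ sumF≈sum (λ i → x i * pow (x i) m) ⟩
    ∑[ i < N ] (x i * pow (x i) m)
      ≈⟨ sum-cong-≋ {N} (λ i → *-congˡ (detℕ-eWithout x i m)) ⟨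
    ∑[ i < N ] (x i * detℕ (suc m) (eWithout x i ∷ band (e x)))
      ≈⟨ detℕ-∷-∑ m x (eWithout x) (band (e x)) ⟨
    detℕ (suc m) ((λ c → ∑[ i < N ] (x i * eWithout x i c)) ∷ band (e x))
      ≈⟨ detℕ-∷-cong m (band (e x)) (∑x-eWithout x) ⟩
    detℕ (suc m) ((λ c → fromℕ (suc c) * e x (suc c)) ∷ band (e x)) ∎

  detℕ-Mept-step : ∀ {N} (x : Fin N → Carrier) m v →
    detℕ (suc (suc m)) (v ∷ Mept-rows x (suc m))
      ≈ v 0 * detℕ (suc m) ((p x ∘ suc) ∷ Mept-rows x m)
        - fromℕ (suc m) * detℕ (suc m) ((v ∘ suc) ∷ Mept-rows x m)
  detℕ-Mept-step x m v = trans (detℕ-column₀₁ m (v ∷ Mept-rows x (suc m)) (λ _ → refl))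
    (+-cong (*-congˡ (detℕ-cong (suc m) (shifted {p x ∘ suc})))
            (-‿cong (*-congˡ (detℕ-cong (suc m) (shifted {v ∘ suc})))))
    where
    shifted : ∀ {u : ℕ → Carrier} r c → r < suc m → c < suc m →
              (u ∷ λ r c → Mept-rows x (suc m) (suc r) (suc c)) r c ≈ (u ∷ Mept-rows x m) r c
    shifted zero    c _ _ = refl
    shifted (suc r) c _ _ = reflexive (bandD-suc (p x) _ r c)

  detℕ-pow : ∀ {N} (x : Fin N → Carrier) m i →
             detℕ (suc m) (pow (x i) ∷ Mept-rows x m) ≈ fromℕ (m !) * eWithout x i m
  detℕ-pow x zero    i = begin
    detℕ 1 (pow (x i) ∷ Mept-rows x 0)  ≈⟨ detℕ-1 (pow (x i) ∷ Mept-rows x 0) ⟩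
    1#                                  ≈⟨ trans (*-cong (+-identityʳ 1#) (reflexive (eWithout-zero x i)))
                                                 (*-identityˡ 1#) ⟨
    fromℕ 1 * eWithout x i 0            ∎
  detℕ-pow {N} x (suc m) i = begin
    detℕ (suc (suc m)) (pow y ∷ Mept-rows x (suc m))
      ≈⟨ detℕ-Mept-step x m (pow y) ⟩
    1# * detℕ (suc m) ((p x ∘ suc) ∷ D) - K * detℕ (suc m) ((λ c → y * pow y c) ∷ D)
      ≈⟨ +-cong (trans (*-identityˡ _) powerSums)
                (-‿cong (*-congˡ (trans (detℕ-∷-*ˡ m y (pow y) D) (*-congˡ (detℕ-pow x m i))))) ⟩
    F * (K * e x (suc m)) - K * (y * (F * ε m))
      ≈⟨ +-cong (x∙yz≈yx∙z F K _)
                (-‿cong (trans (*-congˡ (x∙yz≈y∙xz y F (ε m))) (sym (*-assoc K F _)))) ⟩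
    (K * F) * e x (suc m) - (K * F) * (y * ε m)
      ≈⟨ x[y-z]≈xy-xz (K * F) _ _ ⟨
    (K * F) * (e x (suc m) - y * ε m)
      ≈⟨ *-cong (sym (fromℕ-* (suc m) (m !))) (trans (+-congʳ (e-split x i m)) (x+y-y≈x _ _)) ⟩
    fromℕ (suc m !) * ε (suc m) ∎
    where
    y = x i
    ε = eWithout x i
    D = Mept-rows x m
    F = fromℕ (m !)
    K = fromℕ (suc m)
    powerSums : detℕ (suc m) ((p x ∘ suc) ∷ D) ≈ F * (K * e x (suc m))
    powerSums = begin
      detℕ (suc m) ((p x ∘ suc) ∷ D)
        ≈⟨ detℕ-∷-cong m D (λ c → sumF≈sum λ j → x j * pow (x j) c) ⟩
      detℕ (suc m) ((λ c → ∑[ j < N ] (x j * pow (x j) c)) ∷ D)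
        ≈⟨ detℕ-∷-∑ m x (λ j → pow (x j)) D ⟩
      ∑[ j < N ] (x j * detℕ (suc m) (pow (x j) ∷ D))
        ≈⟨ sum-cong-≋ {N} (λ j → trans (*-congˡ (detℕ-pow x m j)) (x∙yz≈y∙xz (x j) F _)) ⟩
      ∑[ j < N ] (F * (x j * eWithout x j m))
        ≈⟨ *-distribˡ-sum F (λ j → x j * eWithout x j m) ⟨
      F * ∑[ j < N ] (x j * eWithout x j m)
        ≈⟨ *-congˡ (∑x-eWithout x m) ⟩
      F * (K * e x (suc m)) ∎


module Centre {c ℓ} (R : Ring c ℓ) where
  open Ring R hiding (zero)
  open import Algebra.Properties.Ring R using (-‿distribˡ-*; -‿distribʳ-*)
  open import Relation.Binary.Reasoning.Setoid setoid

  Central : Carrier → Set (c ⊔ ℓ)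
  Central a = ∀ b → a * b ≈ b * a

  private
    Z : Set (c ⊔ ℓ)
    Z = Σ Carrier Central

    _+ᶻ_ _*ᶻ_ : Z → Z → Z
    (a , a-central) +ᶻ (b , b-central) = a + b , λ z → begin
      (a + b) * z    ≈⟨ distribʳ z a b ⟩
      a * z + b * z  ≈⟨ +-cong (a-central z) (b-central z) ⟩
      z * a + z * b  ≈⟨ distribˡ z a b ⟨
      z * (a + b)    ∎
    (a , a-central) *ᶻ (b , b-central) = a * b , λ z → begin
      (a * b) * z    ≈⟨ *-assoc a b z ⟩
      a * (b * z)    ≈⟨ *-congˡ (b-central z) ⟩
      a * (z * b)    ≈⟨ *-assoc a z b ⟨
      (a * z) * b    ≈⟨ *-congʳ (a-central z) ⟩
      (z * a) * b    ≈⟨ *-assoc z a b ⟩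
      z * (a * b)    ∎

    -ᶻ_ : Z → Z
    -ᶻ (a , a-central) = - a , λ z → begin
      - a * z        ≈⟨ -‿distribˡ-* a z ⟨
      - (a * z)      ≈⟨ -‿cong (a-central z) ⟩
      - (z * a)      ≈⟨ -‿distribʳ-* z a ⟩
      z * - a        ∎

    0ᶻ 1ᶻ : Z
    0ᶻ = 0# , λ z → trans (zeroˡ z) (sym (zeroʳ z))
    1ᶻ = 1# , λ z → trans (*-identityˡ z) (sym (*-identityʳ z))

    rawCentre : RawRing (c ⊔ ℓ) ℓ
    rawCentre = record
      { Carrier = Z ; _≈_ = λ u v → proj₁ u ≈ proj₁ v
      ; _+_ = _+ᶻ_ ; _*_ = _*ᶻ_ ; -_ = -ᶻ_ ; 0# = 0ᶻ ; 1# = 1ᶻ }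

  proj₁-isRingMonomorphism : IsRingMonomorphism rawCentre rawRing proj₁
  proj₁-isRingMonomorphism = record
    { isRingHomomorphism = record
      { isSemiringHomomorphism = record
        { isNearSemiringHomomorphism = record
          { +-isMonoidHomomorphism = record
            { isMagmaHomomorphism = record
              { isRelHomomorphism = record { cong = λ u≈v → u≈v }
              ; homo = λ _ _ → refl }
            ; ε-homo = refl }
          ; *-homo = λ _ _ → refl }
        ; 1#-homo = refl }
      ; -‿homo = λ _ → refl }
    ; injective = λ u≈v → u≈v }

  centre : CommutativeRing (c ⊔ ℓ) ℓ
  centre = record
    { Carrier = Z ; _≈_ = λ u v → proj₁ u ≈ proj₁ v
    ; _+_ = _+ᶻ_ ; _*_ = _*ᶻ_ ; -_ = -ᶻ_ ; 0# = 0ᶻ ; 1# = 1ᶻ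
    ; isCommutativeRing = record
      { isRing = RingMonomorphism.isRing proj₁-isRingMonomorphism isRing
      ; *-comm = λ u v → proj₂ u (proj₁ v) } }

module Transport {c₁ ℓ₁ c₂ ℓ₂} (R₁ : Ring c₁ ℓ₁) (R₂ : Ring c₂ ℓ₂)
                 {f : Ring.Carrier R₁ → Ring.Carrier R₂}
                 (f-isRingHomomorphism : IsRingHomomorphism (Ring.rawRing R₁) (Ring.rawRing R₂) f) where
  private
    module R₁ = Ring R₁
    module S₁ = Sym R₁
    module D₁ = Determinant R₁
    module E₁ = Symmetric R₁
  open Ring R₂ hiding (zero)
  open Sym R₂
  open Sums R₂
  open Determinant R₂
  open import Algebra.Properties.Semiring.Sum semiring using (sum)
  open import Algebra.Properties.Semiring.Sum R₁.semiring using () renaming (sum to sum₁)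
  open Symmetric R₂ using (eWithout)
  open IsRingHomomorphism f-isRingHomomorphism

  sum-homo : ∀ {n} {g : Fin n → R₁.Carrier} {h} → (∀ i → f (g i) ≈ h i) → f (sum₁ g) ≈ sum h
  sum-homo {zero}  _   = 0#-homo
  sum-homo {suc n} g≈h = trans (+-homo _ _) (+-cong (g≈h zero) (sum-homo (g≈h ∘ suc)))

  sumF-homo : ∀ {n} {g : Fin n → R₁.Carrier} {h} → (∀ i → f (g i) ≈ h i) → f (S₁.sumF g) ≈ sumF h
  sumF-homo {zero}  _   = 0#-homo
  sumF-homo {suc n} g≈h = trans (+-homo _ _) (+-cong (g≈h zero) (sumF-homo (g≈h ∘ suc)))

  sgn-homo : ∀ k → f (S₁.sgn k) ≈ sgn k
  sgn-homo zero    = 1#-homo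
  sgn-homo (suc k) = trans (-‿homo _) (-‿cong (sgn-homo k))

  fromℕ-homo : ∀ k → f (S₁.fromℕ k) ≈ fromℕ k
  fromℕ-homo zero    = 0#-homo
  fromℕ-homo (suc k) = trans (+-homo _ _) (+-cong 1#-homo (fromℕ-homo k))

  pow-homo : ∀ a k → f (S₁.pow a k) ≈ pow (f a) k
  pow-homo a zero    = 1#-homo
  pow-homo a (suc k) = trans (*-homo _ _) (*-congˡ (pow-homo a k))

  e-homo : ∀ {N} (x : Fin N → R₁.Carrier) k → f (S₁.e x k) ≈ e (f ∘ x) k
  e-homo {zero}  x zero    = 1#-homo
  e-homo {zero}  x (suc k) = 0#-homo
  e-homo {suc N} x zero    = 1#-homo
  e-homo {suc N} x (suc k) =
    trans (+-homo _ _) (+-cong (trans (*-homo _ _) (*-congˡ (e-homo (x ∘ suc) k))) (e-homo (x ∘ suc) (suc k)))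

  eWithout-homo : ∀ {N} (x : Fin N → R₁.Carrier) i k → f (E₁.eWithout x i k) ≈ eWithout (f ∘ x) i k
  eWithout-homo {suc N} x i = e-homo (removeAt x i)

  p-homo : ∀ {N} (x : Fin N → R₁.Carrier) k → f (S₁.p x k) ≈ p (f ∘ x) k
  p-homo x zero    = 0#-homo
  p-homo x (suc k) = sumF-homo λ i → pow-homo (x i) (suc k)

  band-homo : ∀ {g : ℕ → R₁.Carrier} {h} → (∀ k → f (g k) ≈ h k) →
              ∀ r c → f (S₁.band g r c) ≈ band h r c
  band-homo g≈h r c with r ≤ᵇ c
  ... | true  = g≈h (c ∸ r)
  ... | false = 0#-homo

  bandD-homo : ∀ {g : ℕ → R₁.Carrier} {h d d′} → (∀ k → f (g k) ≈ h k) → f d ≈ d′ →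
               ∀ r c → f (S₁.bandD g d r c) ≈ bandD h d′ r c
  bandD-homo g≈h d≈d′ r c with r ≤ᵇ c | r ≡ᵇ c
  ... | true  | true  = d≈d′
  ... | true  | false = g≈h (c ∸ r)
  ... | false | _     = 0#-homo

  detℕ-homo : ∀ k (A : Matrix R₁.Carrier) → f (D₁.detℕ k A) ≈ detℕ k (λ r c → f (A r c))
  detℕ-homo zero    A = 1#-homo
  detℕ-homo (suc k) A = sum-homo {suc k} λ j → trans (*-homo _ _) (*-cong (sgn-homo (toℕ j))
    (trans (*-homo (A 0 (toℕ j)) _) (*-congˡ (detℕ-homo k (D₁.minorMatrix (toℕ j) A)))))

  detℕ-∷-homo : ∀ k (v : ℕ → R₁.Carrier) (B : Matrix R₁.Carrier) {v′ B′} →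
    (∀ c → f (v c) ≈ v′ c) → (∀ r c → f (B r c) ≈ B′ r c) →
    f (D₁.detℕ (suc k) (v ∷ B)) ≈ detℕ (suc k) (v′ ∷ B′)
  detℕ-∷-homo k v B {v′} {B′} v≈v′ B≈B′ = trans (detℕ-homo (suc k) (v ∷ B))
    (detℕ-cong (suc k) {λ r c → f ((v ∷ B) r c)} {v′ ∷ B′} λ
      { zero    c _ _ → v≈v′ c
      ; (suc r) c _ _ → B≈B′ r c
      })

module Superpolynomial {c ℓ} (R : Ring c ℓ) {N} (x : Fin N → Ring.Carrier R)
                       (x-central : ∀ i → Centre.Central R (x i)) where
  open Ring R hiding (zero)
  open Sym R
  open Scalars R using (fromℕ-central)
  open Sums R
  open Determinant R
  open Symmetric R
  open Centre R
  open import Algebra.Properties.Semiring.Sum semiring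
  open import Relation.Binary.Reasoning.Setoid setoid
  private
    module Z = CommutativeRing centre
    Rᶻ = Z.ring
    module Sᶻ = Sym Rᶻ
    module Dᶻ = Determinant Rᶻ
    module Eᶻ = Symmetric Rᶻ
    module Bᶻ = Bosonic centre
    module π = Transport Rᶻ R (IsRingMonomorphism.isRingHomomorphism proj₁-isRingMonomorphism)

  x̂ : Fin N → CommutativeRing.Carrier centre
  x̂ i = x i , x-central i

  p≈det-Mpe : ∀ m → p x (suc m) ≈ det (Mpe x (suc m))
  p≈det-Mpe m = begin
    p x (suc m)
      ≈⟨ π.p-homo x̂ (suc m) ⟨
    proj₁ (Sᶻ.p x̂ (suc m))
      ≈⟨ Bᶻ.p≈detℕ x̂ m ⟩
    proj₁ (Dᶻ.detℕ (suc m) ((λ c → Sᶻ.fromℕ (suc c) Z.* Sᶻ.e x̂ (suc c)) ∷ Sᶻ.band (Sᶻ.e x̂)))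
      ≈⟨ π.detℕ-∷-homo m (λ c → Sᶻ.fromℕ (suc c) Z.* Sᶻ.e x̂ (suc c)) (Sᶻ.band (Sᶻ.e x̂))
                       (λ c → *-cong (π.fromℕ-homo (suc c)) (π.e-homo x̂ (suc c)))
                       (π.band-homo {Sᶻ.e x̂} (π.e-homo x̂)) ⟩
    detℕ (suc m) ((λ c → fromℕ (suc c) * e x (suc c)) ∷ band (e x))
      ≈⟨ det≈detℕ (Mpe x (suc m)) ((λ c → fromℕ (suc c) * e x (suc c)) ∷ band (e x))
                  (λ { zero j → refl ; (suc i) j → refl }) ⟨
    det (Mpe x (suc m)) ∎

  e≈det-Mep : ∀ m → fromℕ (suc m !) * e x (suc m) ≈ det (Mep x (suc m))
  e≈det-Mep m = begin
    fromℕ (suc m !) * e x (suc m)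
      ≈⟨ *-cong (π.fromℕ-homo (suc m !)) (π.e-homo x̂ (suc m)) ⟨
    proj₁ (Sᶻ.fromℕ (suc m !) Z.* Sᶻ.e x̂ (suc m))
      ≈⟨ Bᶻ.e≈detℕ-Mepℕ x̂ m ⟩
    proj₁ (Dᶻ.detℕ (suc m) (Eᶻ.Mepℕ x̂))
      ≈⟨ π.detℕ-∷-homo m (Sᶻ.p x̂ ∘ suc) (λ r → Sᶻ.bandD (Sᶻ.p x̂) (Sᶻ.fromℕ (suc r)) r)
                       (π.p-homo x̂ ∘ suc)
                       (λ r → π.bandD-homo {Sᶻ.p x̂} (π.p-homo x̂) (π.fromℕ-homo (suc r)) r) ⟩
    detℕ (suc m) (Mepℕ x)
      ≈⟨ det≈detℕ (Mep x (suc m)) (Mepℕ x) (λ { zero j → refl ; (suc i) j → refl }) ⟨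
    det (Mep x (suc m)) ∎

  pt≈det-Mpte : ∀ θ n → pt x θ n ≈ det (Mpte x θ n)
  pt≈det-Mpte θ n = begin
    pt x θ n
      ≈⟨ sumF≈sum (λ i → θ i * pow (x i) n) ⟩
    ∑[ i < N ] (θ i * pow (x i) n)
      ≈⟨ sum-cong-≋ {N} (λ i → *-congˡ (eWithout-row i)) ⟨
    ∑[ i < N ] (θ i * detℕ (suc n) (eWithout x i ∷ band (e x)))
      ≈⟨ detℕ-∷-∑ n θ (eWithout x) (band (e x)) ⟨
    detℕ (suc n) ((λ c → ∑[ i < N ] (θ i * eWithout x i c)) ∷ band (e x))
      ≈⟨ detℕ-∷-cong n (band (e x)) (λ c → sym (et≈∑θeWithout x θ x-central c)) ⟩
    detℕ (suc n) (et x θ ∷ band (e x))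
      ≈⟨ det≈detℕ (Mpte x θ n) (et x θ ∷ band (e x)) (λ { zero j → refl ; (suc i) j → refl }) ⟨
    det (Mpte x θ n) ∎
    where
    eWithout-row : ∀ i → detℕ (suc n) (eWithout x i ∷ band (e x)) ≈ pow (x i) n
    eWithout-row i = begin
      detℕ (suc n) (eWithout x i ∷ band (e x))
        ≈⟨ π.detℕ-∷-homo n (Eᶻ.eWithout x̂ i) (Sᶻ.band (Sᶻ.e x̂))
                         (π.eWithout-homo x̂ i) (π.band-homo {Sᶻ.e x̂} (π.e-homo x̂)) ⟨
      proj₁ (Dᶻ.detℕ (suc n) (Eᶻ.eWithout x̂ i ∷ Sᶻ.band (Sᶻ.e x̂)))
        ≈⟨ Bᶻ.detℕ-eWithout x̂ i n ⟩
      proj₁ (Sᶻ.pow (x̂ i) n)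
        ≈⟨ π.pow-homo (x̂ i) n ⟩
      pow (x i) n ∎

  et≈det-Mept : ∀ θ n → fromℕ (n !) * et x θ n ≈ det (Mept x θ n)
  et≈det-Mept θ n = begin
    fromℕ (n !) * et x θ n
      ≈⟨ *-congˡ (et≈∑θeWithout x θ x-central n) ⟩
    fromℕ (n !) * ∑[ i < N ] (θ i * eWithout x i n)
      ≈⟨ *-distribˡ-sum (fromℕ (n !)) (λ i → θ i * eWithout x i n) ⟩
    ∑[ i < N ] (fromℕ (n !) * (θ i * eWithout x i n))
      ≈⟨ sum-cong-≋ {N} (λ i → trans (sym (*-assoc _ _ _))
                                     (trans (*-congʳ (fromℕ-central (n !) (θ i))) (*-assoc _ _ _))) ⟩
    ∑[ i < N ] (θ i * (fromℕ (n !) * eWithout x i n))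
      ≈⟨ sum-cong-≋ {N} (λ i → *-congˡ (pow-row i)) ⟨
    ∑[ i < N ] (θ i * detℕ (suc n) (pow (x i) ∷ Mept-rows x n))
      ≈⟨ detℕ-∷-∑ n θ (λ i → pow (x i)) (Mept-rows x n) ⟨
    detℕ (suc n) ((λ c → ∑[ i < N ] (θ i * pow (x i) c)) ∷ Mept-rows x n)
      ≈⟨ detℕ-∷-cong n (Mept-rows x n) (λ c → sumF≈sum (λ i → θ i * pow (x i) c)) ⟨
    detℕ (suc n) (pt x θ ∷ Mept-rows x n)
      ≈⟨ det≈detℕ (Mept x θ n) (pt x θ ∷ Mept-rows x n) (λ { zero j → refl ; (suc i) j → refl }) ⟨
    det (Mept x θ n) ∎
    where
    pow-row : ∀ i → detℕ (suc n) (pow (x i) ∷ Mept-rows x n) ≈ fromℕ (n !) * eWithout x i n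
    pow-row i = begin
      detℕ (suc n) (pow (x i) ∷ Mept-rows x n)
        ≈⟨ π.detℕ-∷-homo n (Sᶻ.pow (x̂ i)) (Eᶻ.Mept-rows x̂ n) (π.pow-homo (x̂ i))
                         (λ r → π.bandD-homo {Sᶻ.p x̂} (π.p-homo x̂) (π.fromℕ-homo (n ∸ r)) r) ⟨
      proj₁ (Dᶻ.detℕ (suc n) (Sᶻ.pow (x̂ i) ∷ Eᶻ.Mept-rows x̂ n))
        ≈⟨ Bᶻ.detℕ-pow x̂ n i ⟩
      proj₁ (Sᶻ.fromℕ (n !) Z.* Eᶻ.eWithout x̂ i n)
        ≈⟨ *-cong (π.fromℕ-homo (n !)) (π.eWithout-homo x̂ i n) ⟩
      fromℕ (n !) * eWithout x i n ∎

proposition3p8 : ∀ {c ℓ} (R : Ring c ℓ) (N : ℕ) (x θ : Fin N → Ring.Carrier R)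
    → Sym.SuperVars R x θ
    → (∀ m → Ring._≈_ R (Sym.p R x (suc m)) (Sym.det R (Sym.Mpe R x (suc m))))
    × (∀ m → Ring._≈_ R (Ring._*_ R (Sym.fromℕ R (suc m !)) (Sym.e R x (suc m)))
                        (Sym.det R (Sym.Mep R x (suc m))))
    × (∀ n → Ring._≈_ R (Sym.pt R x θ n) (Sym.det R (Sym.Mpte R x θ n)))
    × (∀ n → Ring._≈_ R (Ring._*_ R (Sym.fromℕ R (n !)) (Sym.et R x θ n))
                        (Sym.det R (Sym.Mept R x θ n)))
proposition3p8 R N x θ (x-central , _) = p≈det-Mpe , e≈det-Mep , pt≈det-Mpte θ , et≈det-Mept θ
  where open Superpolynomial R x x-central
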